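{- Let $\mathbb{T}$ be a structure over a vocabulary $\mathcal{V}$ satisfying: (1) $\mathbb{T}$ is homogeneous; (2) $\mathbb{T}^d/{\simeq}$ is finite for every $d\in\mathbb{N}_+$, and there is an algorithm that, given $d$, outputs a list of quantifier-free formulas defining the equivalence classes of $\simeq$ on $\mathbb{T}^d$; (3) satisfiability in $\mathbb{T}$ of any quantifier-free $\mathcal{V}[\mathbb{T}]$-formula is decidable. Then, for every finite relational vocabulary $\mathcal{Q}$ disjoint from $\mathcal{V}[\mathbb{T}]$, the covering pre-order $\preceq$ on configurations satisfies, for every $\mathbb{T}$-predicate automaton $(\mathcal{Q},\Sigma\times\mathbb{T},\delta,\varphi_{\mathsf{start}},F)$: (i) $\preceq$ is decidable; (ii) given any configuration $\mathcal{C}$, one can effectively compute a finite set $\mathscr{C}$ of successors of $\mathcal{C}$ such that for every successor $\mathcal{C}'$ of $\mathcal{C}$ there is $\bar{\mathcal{C}}'\in\mathscr{C}$ with $\bar{\mathcal{C}}'\preceq\mathcal{C}'$; (iii) for all configurations $\bar{\mathcal{C}}\preceq\mathcal{C}$, if $\mathcal{C}$ is accepting then $\bar{\mathcal{C}}$ is accepting, and for every $\mathcal{C}'$ with $\mathcal{C}\to\mathcal{C}'$ there is $\bar{\mathcal{C}}'$ with $\bar{\mathcal{C}}\to\bar{\mathcal{C}}'$.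
   Context: Standing computability assumptions: elements of $\mathbb{T}$ and symbols of $\mathcal{V}$ are finitely representable, and interpretations of the symbols are computable. For a set $V$ of elements, $N(V)$ is the substructure generated by $V$; $N(\vec a)$ that of the entries of $\vec a$. For $\vec a,\vec b\in\mathbb{T}^d$, $\vec a\simeq\vec b$ if there is an isomorphism $\beta:N(\vec a)\to N(\vec b)$ with $\beta(\vec a)=\vec b$. $\mathbb{T}$ is homogeneous if every isomorphism between two finitely generated substructures of $\mathbb{T}$ extends to an automorphism of $\mathbb{T}$. $\mathcal{V}[\mathbb{T}]$ expands $\mathcal{V}$ by a constant per element of $\mathbb{T}$. A $\mathbb{T}$-predicate automaton is $A=(\mathcal{Q},\Sigma\times\mathbb{T},\delta,\varphi_{\mathsf{start}},F)$ with $\Sigma$ finite; $\mathcal{F}_+(\mathcal{V},\mathcal{Q})$ denotes quantifier-free $(\mathcal{V}\cup\mathcal{Q})$-formulas with all $\mathcal{Q}$-atoms positive; $\varphi_{\mathsf{start}}\in\mathcal{F}_+(\mathcal{V},\mathcal{Q})$ has no free variables; $F\subseteq\mathcal{Q}$; $\delta:\mathcal{Q}\times\Sigma\to\mathcal{F}_+(\mathcal{V},\mathcal{Q})$ with the free variables of $\delta(q,\sigma)$ among $v_0,\dots,v_{\mathsf{ar}(q)}$. States are ground atoms $q(a_1,\dots,a_{\mathsf{ar}(q)})$, $a_j\in\mathbb{T}$; $\hat\delta(q(a_1,\dots),\langle\sigma:a_0\rangle)$ is $\delta(q,\sigma)$ with $v_j\mapsto a_j$ and $\mathcal{V}$-atoms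 evaluated in $\mathbb{T}$. A configuration is a finite set of states (a conjunction); accepting if all its predicate symbols lie in $F$. $\mathcal{C}\xrightarrow{\sigma:a}\mathcal{C}'$ iff $\mathcal{C}'$ is a cube of the DNF of $\bigwedge_{t\in\mathcal{C}}\hat\delta(t,\langle\sigma:a\rangle)$; $\mathcal{C}\to\mathcal{C}'$ ($\mathcal{C}'$ a successor) if this holds for some letter. Covering pre-order: $\mathcal{C}\preceq\mathcal{C}'$ iff there is an automorphism $\pi$ of $\mathbb{T}$ such that $q(\pi(a_1),\dots,\pi(a_{\mathsf{ar}(q)}))\in\mathcal{C}'$ for every $q(a_1,\dots,a_{\mathsf{ar}(q)})\in\mathcal{C}$. -}

module Defs where

open import Data.Nat using (ℕ; zero; suc; _≤_)
open import Data.Fin using (Fin; zero; suc)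
open import Data.Bool using (Bool; true; false)
open import Data.Empty using (⊥)
open import Data.Unit using (⊤)
open import Data.Product using (Σ; Σ-syntax; ∃; _×_; _,_; proj₁)
open import Data.Sum using (_⊎_)
open import Data.Vec using (Vec; []; _∷_; lookup; map)
open import Data.Vec.Relation.Unary.All as VAll using ([]; _∷_)
open import Data.List using (List; []; _∷_; _++_)
open import Data.List.Membership.Propositional using (_∈_)
open import Data.List.Relation.Unary.All using (All)
open import Data.List.Relation.Unary.Any using (Any)
open import Data.List.Relation.Unary.Unique.Propositional using (Unique)
open import Relation.Nullary using (Dec; ¬_)
open import Relation.Binary.PropositionalEquality using (_≡_)
open import Function.Bundles using (_⇔_)

record Vocabulary : Set₁ where
  field
    FunSym : Set
    funAr  : FunSym → ℕ
    RelSym : Set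
    relAr  : RelSym → ℕ
open Vocabulary public

record Structure (V : Vocabulary) : Set₁ where
  field
    Carrier : Set
    fun     : (f : FunSym V) → Vec Carrier (funAr V f) → Carrier
    rel     : (r : RelSym V) → Vec Carrier (relAr V r) → Bool
open Structure public

-- Terms and quantifier-free formulas over 𝒱 with constants from K
-- (K = ⊥ : plain 𝒱-formulas;  K = carrier of 𝕋 : 𝒱[𝕋]-formulas)
-- and variables from X.

module _ (V : Vocabulary) where

  data Term (K X : Set) : Set where
    var : X → Term K X
    con : K → Term K X
    app : (f : FunSym V) → Vec (Term K X) (funAr V f) → Term K X

  data QF (K X : Set) : Set where
    tt ff : QF K X
    eq    : Term K X → Term K X → QF K X
    rl    : (r : RelSym V) → Vec (Term K X) (relAr V r) → QF K X
    neg   : QF K X → QF K X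
    and or : QF K X → QF K X → QF K X

module _ {V : Vocabulary} (T : Structure V) where

  private C = Carrier T

  module _ {K X : Set} (κ : K → C) (ρ : X → C) where
    mutual
      evalT : Term V K X → C
      evalT (var x)    = ρ x
      evalT (con c)    = κ c
      evalT (app f ts) = fun T f (evalTs ts)

      evalTs : ∀ {n} → Vec (Term V K X) n → Vec C n
      evalTs []       = []
      evalTs (t ∷ ts) = evalT t ∷ evalTs ts

    Sat : QF V K X → Set
    Sat tt         = ⊤
    Sat ff         = ⊥
    Sat (eq s t)   = evalT s ≡ evalT t
    Sat (rl r ts)  = rel T r (evalTs ts) ≡ true
    Sat (neg φ)    = ¬ Sat φ
    Sat (and φ ψ)  = Sat φ × Sat ψ
    Sat (or φ ψ)   = Sat φ ⊎ Sat ψ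

  noConst : ⊥ → C
  noConst ()

  idConst : C → C
  idConst c = c

  data Gen (P : C → Set) : C → Set where
    base : ∀ {x} → P x → Gen P x
    app  : (f : FunSym V) (xs : Vec C (funAr V f)) →
           VAll.All (Gen P) xs → Gen P (fun T f xs)

  Entry : ∀ {n} → Vec C n → C → Set
  Entry {n} as x = Σ (Fin n) λ i → lookup as i ≡ x

  mapWith : ∀ {G : C → Set} → ((x : C) → G x → C) →
            ∀ {n} (xs : Vec C n) → VAll.All G xs → Vec C n
  mapWith g []       []       = []
  mapWith g (x ∷ xs) (p ∷ ps) = g x p ∷ mapWith g xs ps

  -- An isomorphism β : N(P) → N(R) between generated substructures.
  -- β is a map on the elements of N(P) (independent of the membership
  -- proof) with inverse, preserving functions and relations.
  record SubIso (P R : C → Set) : Set where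
    field
      fwd      : (x : C) → Gen P x → C
      fwd-irr  : ∀ x (p p′ : Gen P x) → fwd x p ≡ fwd x p′
      fwd-into : ∀ x (p : Gen P x) → Gen R (fwd x p)
      bwd      : (y : C) → Gen R y → C
      bwd-irr  : ∀ y (r r′ : Gen R y) → bwd y r ≡ bwd y r′
      bwd-into : ∀ y (r : Gen R y) → Gen P (bwd y r)
      bwd-fwd  : ∀ x (p : Gen P x) → bwd (fwd x p) (fwd-into x p) ≡ x
      fwd-bwd  : ∀ y (r : Gen R y) → fwd (bwd y r) (bwd-into y r) ≡ y
      fun-pres : ∀ f (xs : Vec C (funAr V f)) (ps : VAll.All (Gen P) xs) →
                 fwd (fun T f xs) (app f xs ps) ≡ fun T f (mapWith fwd xs ps)
      rel-pres : ∀ r (xs : Vec C (relAr V r)) (ps : VAll.All (Gen P) xs) →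
                 rel T r (mapWith fwd xs ps) ≡ rel T r xs
  open SubIso public

  record Aut : Set where
    field
      to       : C → C
      from     : C → C
      from-to  : ∀ x → from (to x) ≡ x
      to-from  : ∀ y → to (from y) ≡ y
      fun-pres : ∀ f (xs : Vec C (funAr V f)) → to (fun T f xs) ≡ fun T f (map to xs)
      rel-pres : ∀ r (xs : Vec C (relAr V r)) → rel T r (map to xs) ≡ rel T r xs
  open Aut public

  Homogeneous : Set
  Homogeneous = ∀ {m n} (as : Vec C m) (bs : Vec C n)
                (β : SubIso (Entry as) (Entry bs)) →
                Σ Aut λ π → ∀ x (p : Gen (Entry as) x) → to π x ≡ fwd β x p

  _≃_ : ∀ {d} → Vec C d → Vec C d → Set
  _≃_ {d} as bs = Σ (SubIso (Entry as) (Entry bs)) λ β →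
    ∀ (i : Fin d) → fwd β (lookup as i) (base (i , _≡_.refl)) ≡ lookup bs i

  _⊨_ : ∀ {d} → Vec C d → QF V ⊥ (Fin d) → Set
  as ⊨ φ = Sat noConst (lookup as) φ

  DefinesClass : ∀ {d} → QF V ⊥ (Fin d) → Set
  DefinesClass {d} φ =
    (Σ (Vec C d) λ as → as ⊨ φ) ×
    (∀ (as bs : Vec C d) → as ⊨ φ → ((bs ⊨ φ) ⇔ (as ≃ bs)))

  ClassAlgorithm : Set
  ClassAlgorithm =
    Σ ((d : ℕ) → List (QF V ⊥ (Fin d))) λ cls →
      ∀ d → 1 ≤ d →
        All DefinesClass (cls d) ×
        (∀ (as : Vec C d) → Any (λ φ → as ⊨ φ) (cls d))

  SatDecidable : Set
  SatDecidable = ∀ n (φ : QF V C (Fin n)) →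
                 Dec (Σ (Fin n → C) λ ρ → Sat idConst ρ φ)

-- Predicate automata.  𝒬 = Fin m with arities ar, Σ = Fin k.

module _ {V : Vocabulary} (T : Structure V) {m : ℕ} (ar : Fin m → ℕ) where

  private C = Carrier T

  -- 𝓕₊(𝒱,𝒬): quantifier-free (𝒱 ∪ 𝒬)-formulas in which 𝒬-atoms
  -- occur only positively (negation only inside pure 𝒱-subformulas)
  data PForm (X : Set) : Set where
    vf  : QF V ⊥ X → PForm X
    qat : (q : Fin m) → Vec (Term V ⊥ X) (ar q) → PForm X
    and or : PForm X → PForm X → PForm X

  State : Set
  State = Σ (Fin m) λ q → Vec C (ar q)

  -- cubes of the DNF of a positive formula whose 𝒱-atoms are evaluated
  -- in 𝕋 under ρ (true ↦ ⊤, false ↦ ⊥; ⊤ has the single cube [],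
  -- ⊥ has none; ∧ distributes; ∨ takes the union)
  data Cube {X : Set} (ρ : X → C) : PForm X → List State → Set where
    cube-vf  : ∀ {φ} → Sat T (noConst T) ρ φ → Cube ρ (vf φ) []
    cube-qat : ∀ q ts → Cube ρ (qat q ts) ((q , evalTs T (noConst T) ρ ts) ∷ [])
    cube-and : ∀ {φ ψ c d} → Cube ρ φ c → Cube ρ ψ d → Cube ρ (and φ ψ) (c ++ d)
    cube-orˡ : ∀ {φ ψ c} → Cube ρ φ c → Cube ρ (or φ ψ) c
    cube-orʳ : ∀ {φ ψ c} → Cube ρ ψ c → Cube ρ (or φ ψ) c

  record PredicateAutomaton (k : ℕ) : Set where
    field
      δ      : (q : Fin m) → Fin k → PForm (Fin (suc (ar q)))
      φstart : PForm ⊥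
      Final  : Fin m → Bool
  open PredicateAutomaton public

  -- configurations: finite sets of states (duplicate-free lists)
  record Config : Set where
    constructor config
    field
      states : List State
      unique : Unique states
  open Config public

  SameSet : List State → List State → Set
  SameSet xs ys = ∀ s → (s ∈ xs) ⇔ (s ∈ ys)

  module _ {k : ℕ} (A : PredicateAutomaton k) where

    env : ∀ {n} → C → Vec C n → Fin (suc n) → C
    env a0 as zero    = a0
    env a0 as (suc j) = lookup as j

    -- cubes of the DNF of  ⋀_{t ∈ 𝒞} δ̂(t, ⟨σ : a⟩)
    data ConjCube (σ : Fin k) (a : C) : List State → List State → Set where
      nil  : ConjCube σ a [] []
      cons : ∀ {q as ts c cs} →
             Cube (env a as) (δ A q σ) c → ConjCube σ a ts cs →
             ConjCube σ a ((q , as) ∷ ts) (c ++ cs)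

    StepOn : Config → Fin k → C → Config → Set
    StepOn 𝒞 σ a 𝒞′ = Σ (List State) λ c →
      ConjCube σ a (states 𝒞) c × SameSet c (states 𝒞′)

    Step : Config → Config → Set
    Step 𝒞 𝒞′ = Σ (Fin k) λ σ → Σ C λ a → StepOn 𝒞 σ a 𝒞′

    Accepting : Config → Set
    Accepting 𝒞 = All (λ s → Final A (proj₁ s) ≡ true) (states 𝒞)

  mapState : (C → C) → State → State
  mapState g (q , as) = q , map g as

  _≼_ : Config → Config → Set
  𝒞 ≼ 𝒞′ = Σ (Aut T) λ π →
    ∀ s → s ∈ states 𝒞 → mapState (to π) s ∈ states 𝒞′

{-# OPTIONS --safe #-}
-- Automorphisms of 𝕋 preserve quantifier-free satisfaction, so they carry DNF cubes of
-- transition formulas to cubes; this gives (iii). By homogeneity two tuples lie in one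
-- orbit iff they satisfy the same class formula, which is decidable, and 𝒞 ≼ 𝒞′ reduces
-- to finitely many such orbit tests once the image of each state of 𝒞 is guessed.
-- For (ii), letters a′ and a of the same class over the entries ā of 𝒞 are related by an
-- automorphism fixing ā, which maps each a′-successor onto an a-successor; hence it
-- suffices to try one solution a of φ(x, ā) for every class formula φ.
module Submission where

open import Defs
open import Data.Nat using (ℕ; zero; suc; _+_; s≤s; z≤n)
open import Data.Fin using (Fin; zero; suc)
import Data.Fin.Properties as Finₚ
open import Data.Bool using (true)
open import Data.Empty using (⊥; ⊥-elim)
open import Data.Product using (Σ; Σ-syntax; ∃; ∃-syntax; _×_; _,_; proj₁; proj₂)
import Data.Product.Properties as Productₚ
open import Data.Sum using (inj₁; inj₂)
open import Data.Product.Function.NonDependent.Propositional using (_×-⇔_)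
open import Data.Sum.Function.Propositional using (_⊎-⇔_)
open import Data.List as List using (List; []; _∷_; _++_; concatMap; cartesianProductWith; deduplicate; allFin)
import Data.List.Properties as Listₚ
open import Data.List.Relation.Unary.All as All using (All; []; _∷_)
import Data.List.Relation.Unary.All.Properties as Allₚ
open import Data.List.Relation.Unary.Any using (Any; here; there; any?)
import Data.List.Relation.Unary.Any.Properties as Anyₚ
open import Data.List.Membership.Propositional using (_∈_; find; lose)
open import Data.List.Membership.Propositional.Properties
import Data.List.Relation.Unary.Unique.DecPropositional.Properties as Uniqueₚ
open import Data.Vec as Vec using (Vec; []; _∷_; lookup)
import Data.Vec.Properties as Vecₚ
open import Function using (id; _∘_)
open import Level using (0ℓ)
open import Function.Bundles using (_⇔_; mk⇔; Equivalence)
open import Function.Properties.Equivalence using (⇔-isEquivalence)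
open import Function.Related.TypeIsomorphisms using (¬-cong-⇔)
open import Relation.Binary.Structures using (IsEquivalence)
open import Relation.Binary.Definitions using (DecidableEquality)
open import Relation.Binary.PropositionalEquality
open import Relation.Nullary using (Dec; yes; no)
import Relation.Nullary.Decidable as Dec

open IsEquivalence (⇔-isEquivalence {ℓ = 0ℓ}) using () renaming (refl to ⇔-refl; reflexive to ≡⇒⇔)

map-cancel : ∀ {A B : Set} {f : A → B} {g : B → A} → (∀ x → g (f x) ≡ x) →
             ∀ {n} (xs : Vec A n) → Vec.map g (Vec.map f xs) ≡ xs
map-cancel {f = f} {g} g∘f≗id xs = begin
  Vec.map g (Vec.map f xs) ≡⟨ Vecₚ.map-∘ g f xs ⟨
  Vec.map (g ∘ f) xs       ≡⟨ Vecₚ.map-cong g∘f≗id xs ⟩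
  Vec.map id xs            ≡⟨ Vecₚ.map-id xs ⟩
  xs                       ∎
  where open ≡-Reasoning

lookup⇒map≡ : ∀ {A : Set} {g : A → A} {n} (u v : Vec A n) →
              (∀ i → g (lookup u i) ≡ lookup v i) → Vec.map g u ≡ v
lookup⇒map≡ []      []      _      = refl
lookup⇒map≡ (x ∷ u) (y ∷ v) g∘u≗v = cong₂ _∷_ (g∘u≗v zero) (lookup⇒map≡ u v (g∘u≗v ∘ suc))

module Automorphisms {V : Vocabulary} (T : Structure V) where

  private
    C : Set
    C = Carrier T

  id-aut : Aut T
  id-aut = record
    { to       = id
    ; from     = id
    ; from-to  = λ _ → refl
    ; to-from  = λ _ → refl
    ; fun-pres = λ f xs → cong (fun T f) (sym (Vecₚ.map-id xs))
    ; rel-pres = λ r xs → cong (rel T r) (Vecₚ.map-id xs)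
    }

  inverse : Aut T → Aut T
  inverse π = record
    { to       = from π
    ; from     = to π
    ; from-to  = to-from π
    ; to-from  = from-to π
    ; fun-pres = fun-pres⁻¹
    ; rel-pres = rel-pres⁻¹
    }
    where
    open ≡-Reasoning

    fun-pres⁻¹ : ∀ f (xs : Vec C (funAr V f)) →
                 from π (fun T f xs) ≡ fun T f (Vec.map (from π) xs)
    fun-pres⁻¹ f xs = begin
      from π (fun T f xs)                      ≡⟨ cong (from π ∘ fun T f) (map-cancel (to-from π) xs) ⟨
      from π (fun T f (Vec.map (to π) ys))     ≡⟨ cong (from π) (Aut.fun-pres π f ys) ⟨
      from π (to π (fun T f ys))               ≡⟨ from-to π _ ⟩
      fun T f ys                               ∎
      where ys = Vec.map (from π) xs

    rel-pres⁻¹ : ∀ r (xs : Vec C (relAr V r)) →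
                 rel T r (Vec.map (from π) xs) ≡ rel T r xs
    rel-pres⁻¹ r xs = begin
      rel T r (Vec.map (from π) xs)                  ≡⟨ Aut.rel-pres π r _ ⟨
      rel T r (Vec.map (to π) (Vec.map (from π) xs)) ≡⟨ cong (rel T r) (map-cancel (to-from π) xs) ⟩
      rel T r xs                                     ∎

  to-injective : (π : Aut T) {x y : C} → to π x ≡ to π y → x ≡ y
  to-injective π {x} {y} πx≡πy =
    trans (sym (from-to π x)) (trans (cong (from π) πx≡πy) (from-to π y))

  module _ (π : Aut T) {X : Set} {ρ ρ′ : X → C} (ρ′≗πρ : ∀ x → ρ′ x ≡ to π (ρ x)) where

    mutual
      evalT-aut : (t : Term V ⊥ X) → evalT T (noConst T) ρ′ t ≡ to π (evalT T (noConst T) ρ t)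
      evalT-aut (var x)    = ρ′≗πρ x
      evalT-aut (con ())
      evalT-aut (app f ts) = trans (cong (fun T f) (evalTs-aut ts)) (sym (Aut.fun-pres π f _))

      evalTs-aut : ∀ {n} (ts : Vec (Term V ⊥ X) n) →
                   evalTs T (noConst T) ρ′ ts ≡ Vec.map (to π) (evalTs T (noConst T) ρ ts)
      evalTs-aut []       = refl
      evalTs-aut (t ∷ ts) = cong₂ _∷_ (evalT-aut t) (evalTs-aut ts)

    Sat-aut : (φ : QF V ⊥ X) → Sat T (noConst T) ρ φ ⇔ Sat T (noConst T) ρ′ φ
    Sat-aut tt        = ⇔-refl
    Sat-aut ff        = ⇔-refl
    Sat-aut (eq s t)  = mk⇔
      (λ s≡t → trans (evalT-aut s) (trans (cong (to π) s≡t) (sym (evalT-aut t))))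
      (λ s≡t → to-injective π (trans (sym (evalT-aut s)) (trans s≡t (evalT-aut t))))
    Sat-aut (rl r ts) = ≡⇒⇔ (cong (_≡ true)
      (sym (trans (cong (rel T r) (evalTs-aut ts)) (Aut.rel-pres π r _))))
    Sat-aut (neg φ)   = ¬-cong-⇔ (Sat-aut φ)
    Sat-aut (and φ ψ) = Sat-aut φ ×-⇔ Sat-aut ψ
    Sat-aut (or φ ψ)  = Sat-aut φ ⊎-⇔ Sat-aut ψ

  ⊨-aut : (π : Aut T) {d : ℕ} (as : Vec C d) (φ : QF V ⊥ (Fin d)) →
          _⊨_ T as φ → _⊨_ T (Vec.map (to π) as) φ
  ⊨-aut π as φ = Equivalence.to (Sat-aut π (λ i → Vecₚ.lookup-map i (to π) as) φ)

module Substitution {V : Vocabulary} (T : Structure V) where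

  private
    C : Set
    C = Carrier T

  module _ {X Y : Set} (s : X → Term V C Y) where

    mutual
      substT : Term V ⊥ X → Term V C Y
      substT (var x)    = s x
      substT (con ())
      substT (app f ts) = app f (substTs ts)

      substTs : ∀ {n} → Vec (Term V ⊥ X) n → Vec (Term V C Y) n
      substTs []       = []
      substTs (t ∷ ts) = substT t ∷ substTs ts

    substQF : QF V ⊥ X → QF V C Y
    substQF tt        = tt
    substQF ff        = ff
    substQF (eq t u)  = eq (substT t) (substT u)
    substQF (rl r ts) = rl r (substTs ts)
    substQF (neg φ)   = neg (substQF φ)
    substQF (and φ ψ) = and (substQF φ) (substQF ψ)
    substQF (or φ ψ)  = or (substQF φ) (substQF ψ)

  module _ {X Y : Set} (s : X → Term V C Y) {ρ : Y → C} {ρ′ : X → C}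
           (s≗ρ′ : ∀ x → evalT T (idConst T) ρ (s x) ≡ ρ′ x) where

    mutual
      evalT-subst : (t : Term V ⊥ X) →
                    evalT T (idConst T) ρ (substT s t) ≡ evalT T (noConst T) ρ′ t
      evalT-subst (var x)    = s≗ρ′ x
      evalT-subst (con ())
      evalT-subst (app f ts) = cong (fun T f) (evalTs-subst ts)

      evalTs-subst : ∀ {n} (ts : Vec (Term V ⊥ X) n) →
                     evalTs T (idConst T) ρ (substTs s ts) ≡ evalTs T (noConst T) ρ′ ts
      evalTs-subst []       = refl
      evalTs-subst (t ∷ ts) = cong₂ _∷_ (evalT-subst t) (evalTs-subst ts)

    Sat-subst : (φ : QF V ⊥ X) → Sat T (idConst T) ρ (substQF s φ) ⇔ Sat T (noConst T) ρ′ φ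
    Sat-subst tt        = ⇔-refl
    Sat-subst ff        = ⇔-refl
    Sat-subst (eq t u)  = ≡⇒⇔ (cong₂ _≡_ (evalT-subst t) (evalT-subst u))
    Sat-subst (rl r ts) = ≡⇒⇔ (cong (λ xs → rel T r xs ≡ true) (evalTs-subst ts))
    Sat-subst (neg φ)   = ¬-cong-⇔ (Sat-subst φ)
    Sat-subst (and φ ψ) = Sat-subst φ ×-⇔ Sat-subst ψ
    Sat-subst (or φ ψ)  = Sat-subst φ ⊎-⇔ Sat-subst ψ

module Oracle {V : Vocabulary} (T : Structure V) (sat? : SatDecidable T) where

  open Substitution T

  private
    C : Set
    C = Carrier T

  _≟_ : DecidableEquality C
  x ≟ y = Dec.map′ proj₂ ((λ ()) ,_) (sat? 0 (eq (con x) (con y)))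

  Sat? : ∀ {X : Set} (ρ : X → C) (φ : QF V ⊥ X) → Dec (Sat T (noConst T) ρ φ)
  Sat? ρ φ = Dec.map′ (λ (_ , sat) → Equivalence.to (ground φ) sat)
                      (λ sat → (λ ()) , Equivalence.from (ground φ) sat)
                      (sat? 0 (substQF (con ∘ ρ) φ))
    where
    ground : ∀ {ρ₀ : Fin 0 → C} φ → Sat T (idConst T) ρ₀ (substQF (con ∘ ρ) φ) ⇔ Sat T (noConst T) ρ φ
    ground = Sat-subst (con ∘ ρ) (λ _ → refl)

module Orbits {V : Vocabulary} (T : Structure V) (hom : Homogeneous T)
              (classes : ClassAlgorithm T) (sat? : SatDecidable T) where

  open Automorphisms T
  open Substitution T
  open Oracle T sat?

  private
    C : Set
    C = Carrier T

    Class : (d : ℕ) → List (QF V ⊥ (Fin d))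
    Class = proj₁ classes

  aut-of-≃ : ∀ {d} {as bs : Vec C d} → _≃_ T as bs → Σ[ π ∈ Aut T ] Vec.map (to π) as ≡ bs
  aut-of-≃ {as = as} {bs} (β , β-as≡bs) =
    let (π , π-extends-β) = hom as bs β
    in π , lookup⇒map≡ as bs λ i → trans (π-extends-β _ (base (i , refl))) (β-as≡bs i)

  class-of : ∀ {n} (as : Vec C (suc n)) → ∃[ φ ] φ ∈ Class (suc n) × _⊨_ T as φ
  class-of as = find (proj₂ (proj₂ classes _ (s≤s z≤n)) as)

  aut-of-class : ∀ {n} {φ} → φ ∈ Class (suc n) → {as bs : Vec C (suc n)} →
                 _⊨_ T as φ → _⊨_ T bs φ → Σ[ π ∈ Aut T ] Vec.map (to π) as ≡ bs
  aut-of-class φ∈ {as} {bs} as⊨φ bs⊨φ =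
    let defines = proj₂ (All.lookup (proj₁ (proj₂ classes _ (s≤s z≤n))) φ∈)
    in aut-of-≃ (Equivalence.to (defines as bs as⊨φ) bs⊨φ)

  orbit? : ∀ {n} (u v : Vec C n) → Dec (Σ[ π ∈ Aut T ] Vec.map (to π) u ≡ v)
  orbit? []         [] = yes (id-aut , refl)
  orbit? u@(_ ∷ _) v =
    let (φ , φ∈ , u⊨φ) = class-of u
    in Dec.map′ (aut-of-class φ∈ u⊨φ)
                (λ (π , πu≡v) → subst (λ w → _⊨_ T w φ) πu≡v (⊨-aut π u φ u⊨φ))
                (Sat? (lookup v) φ)

  solutions : {P : (Fin 1 → C) → Set} → Dec (Σ _ P) → List C
  solutions (yes (ρ , _)) = ρ zero ∷ []
  solutions (no _)        = []

  solutions-complete : {P : (Fin 1 → C) → Set} (dec : Dec (Σ _ P)) → Σ _ P →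
                       Σ[ ρ ∈ (Fin 1 → C) ] ρ zero ∈ solutions dec × P ρ
  solutions-complete (yes (ρ , p)) _ = ρ , here refl , p
  solutions-complete (no ¬sol)   sol = ⊥-elim (¬sol sol)

  anchor : ∀ {d} → Vec C d → Fin (suc d) → Term V C (Fin 1)
  anchor ā zero    = var zero
  anchor ā (suc i) = con (lookup ā i)

  eval-anchor : ∀ {d} (ā : Vec C d) (ρ : Fin 1 → C) (x : Fin (suc d)) →
                evalT T (idConst T) ρ (anchor ā x) ≡ lookup (ρ zero ∷ ā) x
  eval-anchor ā ρ zero    = refl
  eval-anchor ā ρ (suc i) = refl

  -- substQF (anchor ā) φ is the 𝒱[𝕋]-formula φ(x, ā) in the single variable x.
  representatives : ∀ {d} → Vec C d → List C
  representatives {d} ā = concatMap (λ φ → solutions (sat? 1 (substQF (anchor ā) φ))) (Class (suc d))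

  representatives-complete : ∀ {d} (ā : Vec C d) (a′ : C) →
    Σ[ a ∈ C ] a ∈ representatives ā × Σ[ π ∈ Aut T ] Vec.map (to π) (a′ ∷ ā) ≡ a ∷ ā
  representatives-complete ā a′ =
    let (φ , φ∈ , a′ā⊨φ) = class-of (a′ ∷ ā)
        (ρ , ρ₀∈ , ρ⊨) = solutions-complete (sat? 1 (substQF (anchor ā) φ))
                           ((λ _ → a′) , Equivalence.from (anchored φ) a′ā⊨φ)
    in ρ zero , ∈-concatMap⁺ _ (lose φ∈ ρ₀∈) , aut-of-class φ∈ a′ā⊨φ (Equivalence.to (anchored φ) ρ⊨)
    where
    anchored : ∀ {ρ} φ → Sat T (idConst T) ρ (substQF (anchor ā) φ) ⇔ _⊨_ T (ρ zero ∷ ā) φ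
    anchored {ρ} = Sat-subst (anchor ā) (eval-anchor ā ρ)

module States {V : Vocabulary} (T : Structure V) {m : ℕ} (ar : Fin m → ℕ) where

  open Automorphisms T

  private
    C : Set
    C = Carrier T

  mapState-cancel : (π : Aut T) (s : State T ar) →
                    mapState T ar (from π) (mapState T ar (to π) s) ≡ s
  mapState-cancel π (q , as) = cong (q ,_) (map-cancel (from-to π) as)

  size : List (State T ar) → ℕ
  size []             = 0
  size ((q , _) ∷ ts) = ar q + size ts

  entries : (ts : List (State T ar)) → Vec C (size ts)
  entries []              = []
  entries ((_ , as) ∷ ts) = as Vec.++ entries ts

  map-mapState-fixed : ∀ {g : C → C} (ts : List (State T ar)) →
                       Vec.map g (entries ts) ≡ entries ts → List.map (mapState T ar g) ts ≡ ts
  map-mapState-fixed []              _   = refl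
  map-mapState-fixed {g} ((q , as) ∷ ts) fixed =
    let (g-as , g-ts) = Vecₚ.++-injective (Vec.map g as) as
                          (trans (sym (Vecₚ.map-++ g as (entries ts))) fixed)
    in cong₂ _∷_ (cong (q ,_) g-as) (map-mapState-fixed ts g-ts)

module Transitions {V : Vocabulary} (T : Structure V) {m : ℕ} (ar : Fin m → ℕ)
                   {k : ℕ} (A : PredicateAutomaton T ar k) where

  open Automorphisms T

  private
    C : Set
    C = Carrier T

    St : Set
    St = State T ar

  Cube-aut : (π : Aut T) {X : Set} {ρ ρ′ : X → C} → (∀ x → ρ′ x ≡ to π (ρ x)) →
             ∀ {φ c} → Cube T ar ρ φ c → Cube T ar ρ′ φ (List.map (mapState T ar (to π)) c)
  Cube-aut π ρ′≗πρ (cube-vf sat) = cube-vf (Equivalence.to (Sat-aut π ρ′≗πρ _) sat)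
  Cube-aut π {ρ′ = ρ′} ρ′≗πρ (cube-qat q ts) =
    subst (λ as → Cube T ar ρ′ (qat q ts) ((q , as) ∷ [])) (evalTs-aut π ρ′≗πρ ts) (cube-qat q ts)
  Cube-aut π {ρ′ = ρ′} ρ′≗πρ (cube-and {c = c} {d} cube₁ cube₂) =
    subst (Cube T ar ρ′ _) (sym (Listₚ.map-++ (mapState T ar (to π)) c d))
      (cube-and (Cube-aut π ρ′≗πρ cube₁) (Cube-aut π ρ′≗πρ cube₂))
  Cube-aut π ρ′≗πρ (cube-orˡ cube) = cube-orˡ (Cube-aut π ρ′≗πρ cube)
  Cube-aut π ρ′≗πρ (cube-orʳ cube) = cube-orʳ (Cube-aut π ρ′≗πρ cube)

  env-aut : (π : Aut T) (a : C) {n : ℕ} (as : Vec C n) (x : Fin (suc n)) →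
            env T ar A (to π a) (Vec.map (to π) as) x ≡ to π (env T ar A a as x)
  env-aut π a as zero    = refl
  env-aut π a as (suc j) = Vecₚ.lookup-map j (to π) as

  ConjCube-aut : (π : Aut T) {σ : Fin k} {a : C} {ts c : List St} →
                 ConjCube T ar A σ a ts c →
                 ConjCube T ar A σ (to π a) (List.map (mapState T ar (to π)) ts)
                                            (List.map (mapState T ar (to π)) c)
  ConjCube-aut π nil = nil
  ConjCube-aut π {σ} {a} (cons {as = as} {c = c} {cs = cs} cube cc) =
    subst (ConjCube T ar A σ (to π a) _) (sym (Listₚ.map-++ (mapState T ar (to π)) c cs))
      (cons (Cube-aut π (env-aut π a as) cube) (ConjCube-aut π cc))

  HasCube : Fin k → C → St → Set
  HasCube σ a (q , as) = ∃ (Cube T ar (env T ar A a as) (δ A q σ))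

  HasCube-aut : (π : Aut T) {σ : Fin k} {a : C} (t : St) →
                HasCube σ a t → HasCube σ (to π a) (mapState T ar (to π) t)
  HasCube-aut π {a = a} (q , as) (_ , cube) = _ , Cube-aut π (env-aut π a as) cube

  ConjCube⇒HasCube : ∀ {σ a ts c} → ConjCube T ar A σ a ts c → All (HasCube σ a) ts
  ConjCube⇒HasCube nil            = []
  ConjCube⇒HasCube (cons cube cc) = (_ , cube) ∷ ConjCube⇒HasCube cc

  HasCube⇒ConjCube : ∀ {σ a} {ts : List St} → All (HasCube σ a) ts → ∃ (ConjCube T ar A σ a ts)
  HasCube⇒ConjCube []                  = _ , nil
  HasCube⇒ConjCube ((_ , cube) ∷ cubes) = _ , cons cube (proj₂ (HasCube⇒ConjCube cubes))

  accepting-≼ : (𝒞̄ 𝒞 : Config T ar) → _≼_ T ar 𝒞̄ 𝒞 → Accepting T ar A 𝒞 → Accepting T ar A 𝒞̄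
  accepting-≼ _ _ (_ , π𝒞̄⊆𝒞) accepting = All.tabulate λ s∈ → All.lookup accepting (π𝒞̄⊆𝒞 _ s∈)

module Effective {V : Vocabulary} (T : Structure V) (hom : Homogeneous T)
                 (classes : ClassAlgorithm T) (sat? : SatDecidable T)
                 {m : ℕ} (ar : Fin m → ℕ) where

  open Automorphisms T
  open Oracle T sat?
  open Orbits T hom classes sat?
  open States T ar

  private
    C : Set
    C = Carrier T

    St : Set
    St = State T ar

  _≟ₛ_ : DecidableEquality St
  _≟ₛ_ = Productₚ.≡-dec Finₚ._≟_ (Vecₚ.≡-dec _≟_)

  toConfig : List St → Config T ar
  toConfig c = config (deduplicate _≟ₛ_ c) (Uniqueₚ.deduplicate-! _≟ₛ_ c)

  toConfig-sameSet : (c : List St) → SameSet T ar c (Config.states (toConfig c))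
  toConfig-sameSet c _ = deduplicate-∈⇔ _≟ₛ_

  toConfig-map-≼ : (π : Aut T) {c : List St} {𝒞 : Config T ar} → SameSet T ar c (Config.states 𝒞) →
                   _≼_ T ar (toConfig (List.map (mapState T ar (to π)) c)) 𝒞
  toConfig-map-≼ π {𝒞 = 𝒞} c≈𝒞 = inverse π , λ s s∈ →
    let (s′ , s′∈c , s≡πs′) = ∈-map⁻ (mapState T ar (to π)) (∈-deduplicate⁻ _≟ₛ_ _ s∈)
    in subst (_∈ Config.states 𝒞) (sym (trans (cong (mapState T ar (from π)) s≡πs′) (mapState-cancel π s′)))
             (Equivalence.to (c≈𝒞 s′) s′∈c)

  Embeds : List St → List St → ∀ {n} → Vec C n → Vec C n → Set
  Embeds S S′ u v = Σ[ π ∈ Aut T ] Vec.map (to π) u ≡ v × (∀ s → s ∈ S → mapState T ar (to π) s ∈ S′)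

  -- The image of each state of S is guessed in S′ and its arguments are appended to
  -- (u , v); a single automorphism realises all guesses iff the final tuples share an orbit.
  Embeds? : ∀ S S′ {n} (u v : Vec C n) → Dec (Embeds S S′ u v)
  Embeds? [] S′ u v =
    Dec.map′ (λ (π , πu≡v) → π , πu≡v , λ _ ()) (λ (π , πu≡v , _) → π , πu≡v) (orbit? u v)
  Embeds? ((q , as) ∷ S) S′ u v = Dec.map′ embeds-∷ image (any? image? S′)
    where
    ImageOfHead : St → Set
    ImageOfHead t′ = Σ[ π ∈ Aut T ] mapState T ar (to π) (q , as) ≡ t′ × Vec.map (to π) u ≡ v ×
                                    (∀ s → s ∈ S → mapState T ar (to π) s ∈ S′)

    image? : (t′ : St) → Dec (ImageOfHead t′)
    image? (q′ , bs) with q Finₚ.≟ q′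
    ... | no q≢q′ = no λ (_ , πt≡t′ , _) → q≢q′ (cong proj₁ πt≡t′)
    ... | yes refl = Dec.map′ split join (Embeds? S S′ (as Vec.++ u) (bs Vec.++ v))
      where
      split : Embeds S S′ (as Vec.++ u) (bs Vec.++ v) → ImageOfHead (q , bs)
      split (π , π[as++u]≡bs++v , πS⊆S′) =
        let (πas≡bs , πu≡v) = Vecₚ.++-injective (Vec.map (to π) as) bs
                                (trans (sym (Vecₚ.map-++ (to π) as u)) π[as++u]≡bs++v)
        in π , cong (q ,_) πas≡bs , πu≡v , πS⊆S′

      join : ImageOfHead (q , bs) → Embeds S S′ (as Vec.++ u) (bs Vec.++ v)
      join (π , refl , πu≡v , πS⊆S′) = π , trans (Vecₚ.map-++ (to π) as u) (cong (bs Vec.++_) πu≡v) , πS⊆S′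

    embeds-∷ : Any ImageOfHead S′ → Embeds ((q , as) ∷ S) S′ u v
    embeds-∷ image with (t′ , t′∈S′ , π , πt≡t′ , πu≡v , πS⊆S′) ← find image =
      π , πu≡v , λ { _ (here refl) → subst (_∈ S′) (sym πt≡t′) t′∈S′ ; s (there s∈S) → πS⊆S′ s s∈S }

    image : Embeds ((q , as) ∷ S) S′ u v → Any ImageOfHead S′
    image (π , πu≡v , πS⊆S′) = lose (πS⊆S′ _ (here refl)) (π , refl , πu≡v , λ s → πS⊆S′ s ∘ there)

  ≼-dec : (𝒞 𝒞′ : Config T ar) → Dec (_≼_ T ar 𝒞 𝒞′)
  ≼-dec 𝒞 𝒞′ = Dec.map′ (λ (π , _ , π𝒞⊆𝒞′) → π , π𝒞⊆𝒞′) (λ (π , π𝒞⊆𝒞′) → π , refl , π𝒞⊆𝒞′)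
                        (Embeds? (Config.states 𝒞) (Config.states 𝒞′) [] [])

  cubes : {X : Set} (ρ : X → C) → PForm T ar X → List (List St)
  cubes ρ (vf φ) with Sat? ρ φ
  ... | yes _ = [] ∷ []
  ... | no _  = []
  cubes ρ (qat q ts) = ((q , evalTs T (noConst T) ρ ts) ∷ []) ∷ []
  cubes ρ (and φ ψ)  = cartesianProductWith _++_ (cubes ρ φ) (cubes ρ ψ)
  cubes ρ (or φ ψ)   = cubes ρ φ ++ cubes ρ ψ

  cubes-sound : {X : Set} (ρ : X → C) (φ : PForm T ar X) {c : List St} → c ∈ cubes ρ φ → Cube T ar ρ φ c
  cubes-sound ρ (vf φ) c∈ with Sat? ρ φ
  cubes-sound ρ (vf φ) (here refl) | yes sat = cube-vf sat
  cubes-sound ρ (qat q ts) (here refl) = cube-qat q ts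
  cubes-sound ρ (and φ ψ) c∈
    with (c₁ , c₂ , c₁∈ , c₂∈ , refl) ← ∈-cartesianProductWith⁻ _++_ (cubes ρ φ) (cubes ρ ψ) c∈ =
    cube-and (cubes-sound ρ φ c₁∈) (cubes-sound ρ ψ c₂∈)
  cubes-sound ρ (or φ ψ) c∈ with ∈-++⁻ (cubes ρ φ) c∈
  ... | inj₁ c∈φ = cube-orˡ (cubes-sound ρ φ c∈φ)
  ... | inj₂ c∈ψ = cube-orʳ (cubes-sound ρ ψ c∈ψ)

  cubes-complete : {X : Set} (ρ : X → C) (φ : PForm T ar X) {c : List St} → Cube T ar ρ φ c → c ∈ cubes ρ φ
  cubes-complete ρ (vf φ) (cube-vf sat) with Sat? ρ φ
  ... | yes _    = here refl
  ... | no ¬sat  = ⊥-elim (¬sat sat)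
  cubes-complete ρ (qat q ts) (cube-qat q ts) = here refl
  cubes-complete ρ (and φ ψ) (cube-and cube₁ cube₂) =
    ∈-cartesianProductWith⁺ _++_ (cubes-complete ρ φ cube₁) (cubes-complete ρ ψ cube₂)
  cubes-complete ρ (or φ ψ) (cube-orˡ cube) = ∈-++⁺ˡ (cubes-complete ρ φ cube)
  cubes-complete ρ (or φ ψ) (cube-orʳ cube) = ∈-++⁺ʳ (cubes ρ φ) (cubes-complete ρ ψ cube)

  module _ {k : ℕ} (A : PredicateAutomaton T ar k) where

    open Transitions T ar A

    conjCubes : Fin k → C → List St → List (List St)
    conjCubes σ a []              = [] ∷ []
    conjCubes σ a ((q , as) ∷ ts) =
      cartesianProductWith _++_ (cubes (env T ar A a as) (δ A q σ)) (conjCubes σ a ts)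

    conjCubes-sound : ∀ σ a ts {c} → c ∈ conjCubes σ a ts → ConjCube T ar A σ a ts c
    conjCubes-sound σ a [] (here refl) = nil
    conjCubes-sound σ a ((q , as) ∷ ts) c∈
      with (c₁ , c₂ , c₁∈ , c₂∈ , refl) ← ∈-cartesianProductWith⁻ _++_ _ (conjCubes σ a ts) c∈ =
      cons (cubes-sound _ _ c₁∈) (conjCubes-sound σ a ts c₂∈)

    conjCubes-complete : ∀ {σ a ts c} → ConjCube T ar A σ a ts c → c ∈ conjCubes σ a ts
    conjCubes-complete nil            = here refl
    conjCubes-complete (cons cube cc) =
      ∈-cartesianProductWith⁺ _++_ (cubes-complete _ _ cube) (conjCubes-complete cc)

    successorsVia : Config T ar → Fin k → C → List (Config T ar)
    successorsVia 𝒞 σ a = List.map toConfig (conjCubes σ a (Config.states 𝒞))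

    letters : Config T ar → List C
    letters 𝒞 = representatives (entries (Config.states 𝒞))

    successors : Config T ar → List (Config T ar)
    successors 𝒞 = concatMap (λ σ → concatMap (successorsVia 𝒞 σ) (letters 𝒞)) (allFin k)

    successors-sound : ∀ 𝒞 → All (Step T ar A 𝒞) (successors 𝒞)
    successors-sound 𝒞 =
      Allₚ.concat⁺ (Allₚ.map⁺ (All.universal (λ σ →
        Allₚ.concat⁺ (Allₚ.map⁺ (All.universal (λ a →
          Allₚ.map⁺ (All.tabulate λ c∈ →
            σ , a , _ , conjCubes-sound σ a (Config.states 𝒞) c∈ , toConfig-sameSet _)) (letters 𝒞))))
        (allFin k)))

    successors-complete : ∀ 𝒞 𝒞′ → Step T ar A 𝒞 𝒞′ → Any (λ 𝒞̄′ → _≼_ T ar 𝒞̄′ 𝒞′) (successors 𝒞)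
    successors-complete 𝒞 𝒞′ (σ , a′ , c′ , cc′ , c′≈𝒞′)
      with (a , a∈ , π , π[a′∷ts]≡a∷ts) ← representatives-complete (entries (Config.states 𝒞)) a′ =
      Anyₚ.concatMap⁺ _ (lose (∈-allFin σ) (Anyₚ.concatMap⁺ (successorsVia 𝒞 σ) (lose a∈
        (Anyₚ.map⁺ (lose (conjCubes-complete cc) (toConfig-map-≼ π {c′} {𝒞′} c′≈𝒞′))))))
      where
      cc : ConjCube T ar A σ a (Config.states 𝒞) (List.map (mapState T ar (to π)) c′)
      cc = let (πa′≡a , πts≡ts) = Vecₚ.∷-injective π[a′∷ts]≡a∷ts
           in subst₂ (λ b us → ConjCube T ar A σ b us _) πa′≡a
                     (map-mapState-fixed (Config.states 𝒞) πts≡ts) (ConjCube-aut π cc′)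

    step-≼ : (𝒞̄ 𝒞 : Config T ar) → _≼_ T ar 𝒞̄ 𝒞 → ∀ 𝒞′ → Step T ar A 𝒞 𝒞′ →
             Σ (Config T ar) (Step T ar A 𝒞̄)
    step-≼ _ _ (π , π𝒞̄⊆𝒞) _ (σ , a , _ , cc , _) =
      let (c̄ , cc̄) = HasCube⇒ConjCube (All.tabulate λ {t} t∈ →
                        subst (HasCube σ (from π a)) (mapState-cancel π t)
                          (HasCube-aut (inverse π) _ (All.lookup (ConjCube⇒HasCube cc) (π𝒞̄⊆𝒞 t t∈))))
      in toConfig c̄ , σ , from π a , c̄ , cc̄ , toConfig-sameSet c̄

theorem7p13 : (V : Vocabulary) (T : Structure V) →
    Homogeneous T → ClassAlgorithm T → SatDecidable T →
    (m : ℕ) (ar : Fin m → ℕ) (k : ℕ) (A : PredicateAutomaton T ar k) →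
    ((𝒞 𝒞′ : Config T ar) → Dec (_≼_ T ar 𝒞 𝒞′)) ×
    (Σ (Config T ar → List (Config T ar)) λ succs →
      ∀ 𝒞 → All (Step T ar A 𝒞) (succs 𝒞) ×
            (∀ 𝒞′ → Step T ar A 𝒞 𝒞′ → Any (λ 𝒞̄′ → _≼_ T ar 𝒞̄′ 𝒞′) (succs 𝒞))) ×
    (∀ (𝒞̄ 𝒞 : Config T ar) → _≼_ T ar 𝒞̄ 𝒞 →
      (Accepting T ar A 𝒞 → Accepting T ar A 𝒞̄) ×
      (∀ 𝒞′ → Step T ar A 𝒞 𝒞′ → Σ (Config T ar) λ 𝒞̄′ → Step T ar A 𝒞̄ 𝒞̄′))
theorem7p13 V T hom classes sat? m ar k A =
  ≼-dec ,
  (successors A , λ 𝒞 → successors-sound A 𝒞 , successors-complete A 𝒞) ,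
  λ 𝒞̄ 𝒞 𝒞̄≼𝒞 → accepting-≼ 𝒞̄ 𝒞 𝒞̄≼𝒞 , step-≼ A 𝒞̄ 𝒞 𝒞̄≼𝒞
  where
  open Effective T hom classes sat? ar
  open Transitions T ar A using (accepting-≼)
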